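{- For any integers $n,\alpha,\beta \geq 0$ and $0 \leq m \leq \min(\alpha,\beta)$, $${_m}C^2_{n,(\alpha,\beta)} = \frac{\alpha+\beta+1-2m}{2n+\beta-\alpha+1} \binom{2n+\beta-\alpha+1}{n-\alpha+m}.$$
   Context: For integers $\alpha,\beta, n\ge 0$, consider the integer lattice paths from $(0,\alpha)$ to $(2n+\beta-\alpha,\beta)$ using steps $U=(1,1)$ and $D=(1,-1)$ that stay weakly above the line $y=0$ (such paths have exactly $n$ steps $D$; the empty path is included when $n=0$, $\alpha=\beta$). For $m\ge0$, ${_m}C^2_{n,(\alpha,\beta)}$ is the number of such paths whose minimum $y$-coordinate equals $m$. Convention: $\binom{a}{b}=0$ whenever $a<0$ or $b<0$, and the whole expression is $0$ when the binomial coefficient is $0$. -}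

module Defs where

open import Data.Nat as ℕ using (ℕ; zero; suc)
open import Data.Integer as ℤ using (ℤ; +_; _+_; _-_; _⊓_; _≤_; _≟_; _≤?_)
open import Data.List using (List; []; _∷_; length; filter; map; _++_; last)
open import Data.List.Relation.Unary.All using (All; all?)
open import Data.Maybe using (Maybe; just; nothing)
open import Data.Maybe.Properties using () renaming (≡-dec to ≡-decM)
open import Data.Product using (_×_; _,_)
open import Relation.Nullary using (Dec; yes; no)
open import Relation.Nullary.Decidable using (_×-dec_)
open import Relation.Binary.PropositionalEquality using (_≡_)

-- Lattice steps: U = (1,1), D = (1,-1).
data Step : Set where
  U D : Step

allSeqs : ℕ → List (List Step)
allSeqs zero    = [] ∷ []
allSeqs (suc k) = map (U ∷_) (allSeqs k) ++ map (D ∷_) (allSeqs k)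

heights : ℤ → List Step → List ℤ
heights h []      = h ∷ []
heights h (U ∷ s) = h ∷ heights (h + + 1) s
heights h (D ∷ s) = h ∷ heights (h - + 1) s

endHeight : ℤ → List Step → ℤ
endHeight h []      = h
endHeight h (U ∷ s) = endHeight (h + + 1) s
endHeight h (D ∷ s) = endHeight (h - + 1) s

minHeight : ℤ → List Step → ℤ
minHeight h []      = h
minHeight h (U ∷ s) = h ⊓ minHeight (h + + 1) s
minHeight h (D ∷ s) = h ⊓ minHeight (h - + 1) s

pathLength : ℕ → ℕ → ℕ → ℤ
pathLength n α β = + (2 ℕ.* n ℕ.+ β) - + α

IsPath : ℕ → ℕ → ℕ → ℕ → List Step → Set
IsPath n α β m s =
  (+ length s ≡ pathLength n α β) ×
  (endHeight (+ α) s ≡ + β) ×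
  All (+ 0 ≤_) (heights (+ α) s) ×
  (minHeight (+ α) s ≡ + m)

isPath? : ∀ n α β m s → Dec (IsPath n α β m s)
isPath? n α β m s =
  (+ length s ≟ pathLength n α β) ×-dec
  ((endHeight (+ α) s ≟ + β) ×-dec
  (all? (λ x → + 0 ≤? x) (heights (+ α) s) ×-dec
  (minHeight (+ α) s ≟ + m)))

-- Every path from (0,α) to (2n+β-α,β) has 2n+β-α steps; enumerating all step
-- sequences of length |2n+β-α| covers them (when 2n+β-α < 0 the length
-- condition fails for every sequence, so the count is 0).
-- _mC²_{n,(α,β)}
mC2 : ℕ → ℕ → ℕ → ℕ → ℕ
mC2 m n α β = length (filter (isPath? n α β m) (allSeqs ℤ.∣ pathLength n α β ∣))

-- Binomial coefficient on integers: 0 whenever a < 0 or b < 0.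
ℕbinom : ℕ → ℕ → ℕ
ℕbinom _       zero    = 1
ℕbinom zero    (suc _) = 0
ℕbinom (suc a) (suc b) = ℕbinom a b ℕ.+ ℕbinom a (suc b)

binomℤ : ℤ → ℤ → ℤ
binomℤ (+ a) (+ b) = + ℕbinom a b
binomℤ _     _     = + 0

module Submission where

-- Write α = m + a and β = m + b; the paths have u = n + b − a up steps and L = u + n steps.
-- A path has minimum exactly m iff it stays weakly above m but not above m + 1. Shifting
-- heights by m, the reflection principle counts the paths staying above m as
-- C(L,u) − C(L,a+u+1) and those staying above m + 1 as C(L,u) − C(L,a+u), so that
-- mC2 = C(L,r) − C(L,r+1) with r = a + u. The absorption identity (r+1)·C(L+1,r+1) = (L+1)·C(L,r)
-- turns (L+1)·(C(L,r) − C(L,r+1)) into (2r+1−L)·C(L+1,r+1) = (α+β+1−2m)·C(L+1,r+1), and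
-- C(L+1,r+1) = C(L+1,n+m−α) by symmetry. When α > n + β there are no paths at all, and the
-- binomial coefficient has a negative lower index.

open import Defs

module BinomialCoefficients where

  open import Data.Nat
  open import Data.Nat.Properties
  open import Data.Nat.Tactic.RingSolver using (solve-∀)
  open import Relation.Binary.PropositionalEquality
  open ≡-Reasoning

  n<k⇒ℕbinom≡0 : ∀ {n k} → n < k → ℕbinom n k ≡ 0
  n<k⇒ℕbinom≡0 {zero}  {suc k} _         = refl
  n<k⇒ℕbinom≡0 {suc n} {suc k} (s≤s n<k) =
    cong₂ _+_ (n<k⇒ℕbinom≡0 n<k) (n<k⇒ℕbinom≡0 (m<n⇒m<1+n n<k))

  ℕbinom-diag : ∀ n → ℕbinom n n ≡ 1
  ℕbinom-diag zero    = refl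
  ℕbinom-diag (suc n) = cong₂ _+_ (ℕbinom-diag n) (n<k⇒ℕbinom≡0 (n<1+n n))

  ℕbinom-1 : ∀ n → ℕbinom n 1 ≡ n
  ℕbinom-1 zero    = refl
  ℕbinom-1 (suc n) = cong suc (ℕbinom-1 n)

  ℕbinom-sym : ∀ a b → ℕbinom (a + b) a ≡ ℕbinom (a + b) b
  ℕbinom-sym zero    b    = sym (ℕbinom-diag b)
  ℕbinom-sym (suc a) zero = trans (cong (λ n → ℕbinom n (suc a)) (+-identityʳ (suc a))) (ℕbinom-diag (suc a))
  ℕbinom-sym (suc a) (suc b) = begin
    ℕbinom (a + suc b) a + ℕbinom (a + suc b) (suc a)
      ≡⟨ cong₂ _+_ (ℕbinom-sym a (suc b)) (cong (λ n → ℕbinom n (suc a)) (+-suc a b)) ⟩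
    ℕbinom (a + suc b) (suc b) + ℕbinom (suc a + b) (suc a)
      ≡⟨ cong₂ _+_ (cong (λ n → ℕbinom n (suc b)) (+-suc a b)) (ℕbinom-sym (suc a) b) ⟩
    ℕbinom (suc (a + b)) (suc b) + ℕbinom (suc (a + b)) b
      ≡⟨ +-comm (ℕbinom (suc (a + b)) (suc b)) _ ⟩
    ℕbinom (suc (a + b)) b + ℕbinom (suc (a + b)) (suc b)
      ≡⟨ cong (λ n → ℕbinom n b + ℕbinom n (suc b)) (sym (+-suc a b)) ⟩
    ℕbinom (a + suc b) b + ℕbinom (a + suc b) (suc b) ∎

  ℕbinom-absorb : ∀ n k → suc k * ℕbinom (suc n) (suc k) ≡ suc n * ℕbinom n k
  ℕbinom-absorb zero    zero    = refl
  ℕbinom-absorb zero    (suc k) = *-zeroʳ (suc (suc k))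
  ℕbinom-absorb (suc n) zero    =
    trans (*-identityˡ _) (trans (ℕbinom-1 (suc (suc n))) (sym (*-identityʳ _)))
  ℕbinom-absorb (suc n) (suc k) = begin
    suc (suc k) * (ℕbinom (suc n) (suc k) + ℕbinom (suc n) (suc (suc k)))
      ≡⟨ *-distribˡ-+ (suc (suc k)) (ℕbinom (suc n) (suc k)) _ ⟩
    (ℕbinom (suc n) (suc k) + suc k * ℕbinom (suc n) (suc k)) + suc (suc k) * ℕbinom (suc n) (suc (suc k))
      ≡⟨ cong₂ (λ x y → (ℕbinom (suc n) (suc k) + x) + y) (ℕbinom-absorb n k) (ℕbinom-absorb n (suc k)) ⟩
    (ℕbinom (suc n) (suc k) + suc n * ℕbinom n k) + suc n * ℕbinom n (suc k)
      ≡⟨ +-assoc (ℕbinom (suc n) (suc k)) _ _ ⟩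
    ℕbinom (suc n) (suc k) + (suc n * ℕbinom n k + suc n * ℕbinom n (suc k))
      ≡⟨ cong (ℕbinom (suc n) (suc k) +_) (*-distribˡ-+ (suc n) (ℕbinom n k) _) ⟨
    suc (suc n) * ℕbinom (suc n) (suc k) ∎

  ℕbinom-ballot : ∀ L r K M → M + ℕbinom L (suc r) ≡ ℕbinom L r → suc r + suc r ≡ suc L + K →
           suc L * M ≡ K * ℕbinom (suc L) (suc r)
  ℕbinom-ballot L r K M M+Y≡X 2r+2≡L+1+K = +-cancelʳ-≡ (suc L * Z) (suc L * M) (K * Z) (begin
    suc L * M + suc L * Z         ≡⟨ regroup (suc L) M X Y ⟩
    suc L * (M + Y) + suc L * X   ≡⟨ cong (λ t → suc L * t + suc L * X) M+Y≡X ⟩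
    suc L * X + suc L * X         ≡⟨ cong₂ _+_ (ℕbinom-absorb L r) (ℕbinom-absorb L r) ⟨
    suc r * Z + suc r * Z         ≡⟨ *-distribʳ-+ Z (suc r) (suc r) ⟨
    (suc r + suc r) * Z           ≡⟨ cong (_* Z) 2r+2≡L+1+K ⟩
    (suc L + K) * Z               ≡⟨ *-distribʳ-+ Z (suc L) K ⟩
    suc L * Z + K * Z             ≡⟨ +-comm (suc L * Z) (K * Z) ⟩
    K * Z + suc L * Z             ∎)
    where
    X Y Z : ℕ
    X = ℕbinom L r
    Y = ℕbinom L (suc r)
    Z = ℕbinom (suc L) (suc r)
    regroup : ∀ N M X Y → N * M + N * (X + Y) ≡ N * (M + Y) + N * X
    regroup = solve-∀

module IntegerBinomials where

  open BinomialCoefficients using (n<k⇒ℕbinom≡0; ℕbinom-sym)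
  open import Data.Nat
  open import Data.Nat.Properties
  open import Data.Nat.Tactic.RingSolver using (solve-∀)
  open import Data.Integer as ℤ using (+_; -[1+_])
  import Data.Integer.Properties as ℤ
  open import Data.Product using (_,_; ∃-syntax)
  open import Relation.Nullary using (yes; no)
  open import Relation.Binary.PropositionalEquality
  open ≡-Reasoning

  +m-+n≡+o : ∀ {m n o} → m ≡ n + o → + m ℤ.- + n ≡ + o
  +m-+n≡+o {n = n} {o} refl = begin
    + (n + o) ℤ.- + n        ≡⟨ ℤ.[+m]-[+n]≡m⊖n (n + o) n ⟩
    (n + o) ℤ.⊖ n            ≡⟨ cong ((n + o) ℤ.⊖_) (+-identityʳ n) ⟨
    (n + o) ℤ.⊖ (n + 0)      ≡⟨ ℤ.+-cancelˡ-⊖ n o 0 ⟩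
    + o                      ∎

  m<n⇒∃[o]+m-+n≡-[1+o] : ∀ {m n} → m < n → ∃[ o ] + m ℤ.- + n ≡ -[1+ o ]
  m<n⇒∃[o]+m-+n≡-[1+o] {m} m<n with m≤n⇒∃[o]m+o≡n m<n
  ... | o , refl = o , (begin
    + m ℤ.- + suc (m + o)    ≡⟨ ℤ.[+m]-[+n]≡m⊖n m (suc (m + o)) ⟩
    m ℤ.⊖ suc (m + o)        ≡⟨ cong₂ ℤ._⊖_ (+-identityʳ m) (+-suc m o) ⟨
    (m + 0) ℤ.⊖ (m + suc o)  ≡⟨ ℤ.+-cancelˡ-⊖ m 0 (suc o) ⟩
    -[1+ o ]                 ∎)

  binomℤ-negative : ∀ N o → binomℤ N -[1+ o ] ≡ + 0
  binomℤ-negative (+ _)    o = refl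
  binomℤ-negative -[1+ _ ] o = refl

  m<n⇒binomℤ[+m-+n]≡0 : ∀ N {m n} → m < n → binomℤ N (+ m ℤ.- + n) ≡ + 0
  m<n⇒binomℤ[+m-+n]≡0 N m<n = let o , m-n≡-[1+o] = m<n⇒∃[o]+m-+n≡-[1+o] m<n in
    trans (cong (binomℤ N) m-n≡-[1+o]) (binomℤ-negative N o)

  binomℤ-complement : ∀ N x y r → N + y ≡ x + r → binomℤ (+ N) (+ x ℤ.- + y) ≡ + ℕbinom N r
  binomℤ-complement N x y r N+y≡x+r with y ≤? x
  ... | no y≰x = begin
    binomℤ (+ N) (+ x ℤ.- + y) ≡⟨ m<n⇒binomℤ[+m-+n]≡0 (+ N) x<y ⟩
    + 0                        ≡⟨ cong +_ (n<k⇒ℕbinom≡0 N<r) ⟨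
    + ℕbinom N r               ∎
    where
    x<y : x < y
    x<y = ≰⇒> y≰x
    N<r : N < r
    N<r = +-cancelʳ-< y N r (subst₂ _<_ (sym N+y≡x+r) (+-comm y r) (+-monoˡ-< r x<y))
  ... | yes y≤x with m≤n⇒∃[o]m+o≡n y≤x
  ...   | k , y+k≡x = begin
    binomℤ (+ N) (+ x ℤ.- + y) ≡⟨ cong (binomℤ (+ N)) (+m-+n≡+o {n = y} {k} (sym y+k≡x)) ⟩
    + ℕbinom N k               ≡⟨ cong (λ N → + ℕbinom N k) N≡k+r ⟩
    + ℕbinom (k + r) k         ≡⟨ cong +_ (ℕbinom-sym k r) ⟩
    + ℕbinom (k + r) r         ≡⟨ cong (λ N → + ℕbinom N r) N≡k+r ⟨
    + ℕbinom N r               ∎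
    where
    N≡k+r : N ≡ k + r
    N≡k+r = +-cancelʳ-≡ y N (k + r) (begin
      N + y       ≡⟨ N+y≡x+r ⟩
      x + r       ≡⟨ cong (_+ r) y+k≡x ⟨
      y + k + r   ≡⟨ rearrange y k r ⟩
      k + r + y   ∎)
      where
      rearrange : ∀ y k r → y + k + r ≡ k + r + y
      rearrange = solve-∀

module NonnegativeWalks where

  open BinomialCoefficients using (n<k⇒ℕbinom≡0)
  open import Data.Nat
  open import Data.Nat.Properties
  open import Data.Nat.Tactic.RingSolver using (solve-∀)
  open import Data.Empty using (⊥-elim)
  open import Function using (_∘_)
  open import Relation.Binary.PropositionalEquality
  open ≡-Reasoning

  δ : ℕ → ℕ → ℕ
  δ zero    zero    = 1
  δ zero    (suc _) = 0
  δ (suc _) zero    = 0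
  δ (suc a) (suc b) = δ a b

  δ-diag : ∀ a → δ a a ≡ 1
  δ-diag zero    = refl
  δ-diag (suc a) = δ-diag a

  δ-off : ∀ a b → a ≢ b → δ a b ≡ 0
  δ-off zero    zero    a≢b = ⊥-elim (a≢b refl)
  δ-off zero    (suc b) _   = refl
  δ-off (suc a) zero    _   = refl
  δ-off (suc a) (suc b) a≢b = δ-off a b (a≢b ∘ cong suc)

  walks : ℕ → ℕ → ℕ → ℕ
  walks zero    a       b = δ a b
  walks (suc k) zero    b = walks k 1 b
  walks (suc k) (suc a) b = walks k (suc (suc a)) b + walks k a b

  walks-too-high : ∀ k a b → b + k < a → walks k a b ≡ 0
  walks-too-high zero    a       b b+0<a = δ-off a b λ { refl → <-irrefl (+-identityʳ b) b+0<a }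
  walks-too-high (suc k) (suc a) b b+k+1<a+1 =
    cong₂ _+_ (walks-too-high k (suc (suc a)) b (m<n⇒m<1+n (m<n⇒m<1+n b+k<a)))
              (walks-too-high k a b b+k<a)
    where
    b+k<a : b + k < a
    b+k<a = s≤s⁻¹ (subst (_< suc a) (+-suc b k) b+k+1<a+1)

  walks-too-low : ∀ k a b → a + k < b → walks k a b ≡ 0
  walks-too-low zero    a       b a+0<b = δ-off a b λ { refl → <-irrefl (+-identityʳ a) a+0<b }
  walks-too-low (suc k) zero    b k+1<b = walks-too-low k 1 b k+1<b
  walks-too-low (suc k) (suc a) b a+k+2<b =
    cong₂ _+_ (walks-too-low k (suc (suc a)) b (subst (λ x → suc x < b) (+-suc a k) a+k+2<b))
              (walks-too-low k a b (≤-trans (m≤n+m (suc (a + k)) 2)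
                                             (subst (λ x → suc (suc x) ≤ b) (+-suc a k) a+k+2<b)))

  pascal-split : ∀ k r {X Y p q} → X + ℕbinom k (suc r) ≡ p → Y + ℕbinom k r ≡ q →
                 (X + Y) + ℕbinom (suc k) (suc r) ≡ p + q
  pascal-split k r {X} {Y} hX hY = begin
    (X + Y) + (ℕbinom k r + ℕbinom k (suc r)) ≡⟨ interchange X Y (ℕbinom k r) (ℕbinom k (suc r)) ⟩
    (X + ℕbinom k (suc r)) + (Y + ℕbinom k r) ≡⟨ cong₂ _+_ hX hY ⟩
    _                                         ∎
    where
    interchange : ∀ x y z w → (x + y) + (z + w) ≡ (x + w) + (y + z)
    interchange = solve-∀

  -- Reflection principle: a walk with u up and d down steps from a that dips below 0
  -- reflects, at its first visit to -1, to an unconstrained walk from -2-a,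
  -- and there are C(k, a+u+1) of those.
  walks-reflection : ∀ k a b u d → b + d ≡ a + u → u + d ≡ k →
                     walks k a b + ℕbinom k (suc a + u) ≡ ℕbinom k u
  walks-reflection zero a b zero zero b+0≡a+0 refl = begin
    δ a b + 0 ≡⟨ +-identityʳ (δ a b) ⟩
    δ a b     ≡⟨ cong (δ a) (+-cancelʳ-≡ 0 b a b+0≡a+0) ⟩
    δ a a     ≡⟨ δ-diag a ⟩
    1         ∎
  walks-reflection (suc k) zero b zero .(suc k) b+k+1≡0 refl = ⊥-elim (m+1+n≢0 b b+k+1≡0)
  walks-reflection (suc k) zero b (suc u) d b+d≡1+u u+d≡k =
    trans (cong (_+ ℕbinom (suc k) (suc (suc u))) (sym (+-identityʳ (walks k 1 b))))
          (pascal-split k (suc u) (walks-reflection k 1 b u d b+d≡1+u (suc-injective u+d≡k)) refl)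
  walks-reflection (suc k) (suc a) b zero .(suc k) b+k+1≡a+1 refl =
    pascal-split k (suc a + 0)
      (cong₂ _+_ (walks-too-high k (suc (suc a)) b b+k<a+2) (n<k⇒ℕbinom≡0 k<a+2))
      (walks-reflection k a b 0 k (trans b+k≡a (sym (+-identityʳ a))) refl)
    where
    b+k≡a : b + k ≡ a
    b+k≡a = suc-injective (trans (sym (+-suc b k)) (trans b+k+1≡a+1 (cong suc (+-identityʳ a))))
    b+k<a+2 : b + k < suc (suc a)
    b+k<a+2 = ≤-trans (≤-reflexive (cong suc b+k≡a)) (n≤1+n _)
    k<a+2 : k < suc (suc a + 0)
    k<a+2 = subst (λ t → k < suc (suc t)) (sym (+-identityʳ a)) (≤-<-trans (m≤n+m k b) b+k<a+2)
  walks-reflection (suc k) (suc a) b (suc u) zero b+0≡a+u+2 u+1≡k+1 =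
    pascal-split k (suc a + suc u) up
      (trans (cong₂ _+_ (walks-too-low k a b a+k<b) (n<k⇒ℕbinom≡0 k<r))
             (sym (n<k⇒ℕbinom≡0 (s≤s (≤-reflexive (sym u≡k))))))
    where
    u≡k : u ≡ k
    u≡k = trans (sym (+-identityʳ u)) (suc-injective u+1≡k+1)
    b≡a+u+2 : b ≡ suc (suc (a + u))
    b≡a+u+2 = trans (sym (+-identityʳ b)) (trans b+0≡a+u+2 (cong suc (+-suc a u)))
    a+k<b : a + k < b
    a+k<b = subst (λ x → a + x < b) u≡k (≤-trans (n≤1+n _) (≤-reflexive (sym b≡a+u+2)))
    k<r : k < suc a + suc u
    k<r = s≤s (≤-trans (≤-reflexive (sym u≡k)) (≤-trans (n≤1+n u) (m≤n+m (suc u) a)))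
    up : walks k (suc (suc a)) b + ℕbinom k (suc (suc a + suc u)) ≡ ℕbinom k u
    up = subst (λ x → walks k (suc (suc a)) b + ℕbinom k (suc (suc x)) ≡ ℕbinom k u) (sym (+-suc a u))
           (walks-reflection k (suc (suc a)) b u 0 (trans b+0≡a+u+2 (cong suc (+-suc a u))) (suc-injective u+1≡k+1))
  walks-reflection (suc k) (suc a) b (suc u) (suc d) b+d+1≡a+u+2 u+d+2≡k+1 =
    pascal-split k (suc a + suc u) up
      (walks-reflection k a b (suc u) d (suc-injective (trans (sym (+-suc b d)) b+d+1≡a+u+2))
                                        (trans (sym (+-suc u d)) (suc-injective u+d+2≡k+1)))
    where
    up : walks k (suc (suc a)) b + ℕbinom k (suc (suc a + suc u)) ≡ ℕbinom k u
    up = subst (λ x → walks k (suc (suc a)) b + ℕbinom k (suc (suc x)) ≡ ℕbinom k u) (sym (+-suc a u))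
           (walks-reflection k (suc (suc a)) b u (suc d) (trans b+d+1≡a+u+2 (cong suc (+-suc a u)))
                                                        (suc-injective u+d+2≡k+1))

module Counting where

  open import Data.Nat using (ℕ; suc; _+_)
  open import Data.Nat.Properties using (+-suc)
  open import Data.List using (List; []; _∷_; length; filter; map; _++_)
  open import Data.List.Properties using (filter-++; length-++; filter-none)
  open import Data.List.Relation.Unary.All using (All; []; _∷_)
  open import Data.Empty using (⊥-elim)
  open import Function using (_∘_; _⇔_; Equivalence)
  open import Relation.Nullary using (yes; no)
  open import Relation.Unary using (Pred; Decidable; ∁; _⊆_)
  open import Relation.Unary.Properties using (_∩?_; ∁?)
  open import Relation.Binary.PropositionalEquality

  count : ∀ {a p} {A : Set a} {P : Pred A p} → Decidable P → List A → ℕ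
  count P? xs = length (filter P? xs)

  module _ {a p} {A : Set a} {P : Pred A p} where

    count-++ : (P? : Decidable P) (xs ys : List A) → count P? (xs ++ ys) ≡ count P? xs + count P? ys
    count-++ P? xs ys = trans (cong length (filter-++ P? xs ys)) (length-++ (filter P? xs))

    count-map : (P? : Decidable P) (f : A → A) (xs : List A) → count P? (map f xs) ≡ count (P? ∘ f) xs
    count-map P? f []       = refl
    count-map P? f (x ∷ xs) with P? (f x)
    ... | yes _ = cong suc (count-map P? f xs)
    ... | no  _ = count-map P? f xs

    count-cong : ∀ {q} {Q : Pred A q} (P? : Decidable P) (Q? : Decidable Q) {xs : List A} →
                 All (λ x → P x ⇔ Q x) xs → count P? xs ≡ count Q? xs
    count-cong P? Q? {[]}     []               = refl
    count-cong P? Q? {x ∷ xs} (P⇔Q ∷ P⇔Qs) with P? x | Q? x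
    ... | yes _  | yes _  = cong suc (count-cong P? Q? P⇔Qs)
    ... | no  _  | no  _  = count-cong P? Q? P⇔Qs
    ... | yes px | no ¬qx = ⊥-elim (¬qx (Equivalence.to P⇔Q px))
    ... | no ¬px | yes qx = ⊥-elim (¬px (Equivalence.from P⇔Q qx))

    count-none : (P? : Decidable P) {xs : List A} → All (∁ P) xs → count P? xs ≡ 0
    count-none P? none = cong length (filter-none P? none)

    count-difference : ∀ {q} {Q : Pred A q} (P? : Decidable P) (Q? : Decidable Q) (xs : List A) → Q ⊆ P →
                       count (P? ∩? ∁? Q?) xs + count Q? xs ≡ count P? xs
    count-difference P? Q? []       Q⊆P = refl
    count-difference P? Q? (x ∷ xs) Q⊆P with P? x | Q? x
    ... | yes _  | yes _ = trans (+-suc _ _) (cong suc (count-difference P? Q? xs Q⊆P))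
    ... | yes _  | no _  = cong suc (count-difference P? Q? xs Q⊆P)
    ... | no  _  | no _  = count-difference P? Q? xs Q⊆P
    ... | no ¬px | yes qx = ⊥-elim (¬px (Q⊆P qx))

module LatticePaths where

  open NonnegativeWalks using (δ-diag; δ-off; walks)
  open Counting
  open import Data.Nat as ℕ using (zero; suc; _+_)
  import Data.Nat.Properties as ℕ
  open import Data.Integer as ℤ using (ℤ; +_; +≤+)
  import Data.Integer.Properties as ℤ
  open import Data.List using (List; []; _∷_; length; map; _++_)
  open import Data.List.Properties using (filter-accept; filter-reject)
  open import Data.List.Relation.Unary.All as All using (All; []; _∷_; all?)
  open import Data.List.Relation.Unary.All.Properties using (++⁺; map⁺)
  open import Data.Product using (_×_; _,_)
  open import Function using (_∘_; _⇔_; mk⇔; Equivalence)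
  open import Relation.Nullary using (¬_; yes; no)
  open import Relation.Nullary.Decidable using (_×-dec_)
  open import Relation.Unary using (Pred; Decidable; ∁; _∩_)
  open import Relation.Unary.Properties using (_∩?_; ∁?)
  open import Relation.Binary.PropositionalEquality
  open ≡-Reasoning

  allSeqs-length : ∀ k → All (λ s → length s ≡ k) (allSeqs k)
  allSeqs-length zero    = refl ∷ []
  allSeqs-length (suc k) = ++⁺ (map⁺ (All.map (cong suc) (allSeqs-length k)))
                               (map⁺ (All.map (cong suc) (allSeqs-length k)))

  count-allSeqs-suc : ∀ {p} {P : Pred (List Step) p} (P? : Decidable P) k →
    count P? (allSeqs (suc k)) ≡ count (P? ∘ (U ∷_)) (allSeqs k) + count (P? ∘ (D ∷_)) (allSeqs k)
  count-allSeqs-suc P? k = begin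
    count P? (map (U ∷_) (allSeqs k) ++ map (D ∷_) (allSeqs k))
      ≡⟨ count-++ P? (map (U ∷_) (allSeqs k)) _ ⟩
    count P? (map (U ∷_) (allSeqs k)) + count P? (map (D ∷_) (allSeqs k))
      ≡⟨ cong₂ _+_ (count-map P? (U ∷_) (allSeqs k)) (count-map P? (D ∷_) (allSeqs k)) ⟩
    count (P? ∘ (U ∷_)) (allSeqs k) + count (P? ∘ (D ∷_)) (allSeqs k) ∎

  All-heights-start : ∀ {p} {P : Pred ℤ p} h s → All P (heights h s) → P h
  All-heights-start h []      (ph ∷ _) = ph
  All-heights-start h (U ∷ s) (ph ∷ _) = ph
  All-heights-start h (D ∷ s) (ph ∷ _) = ph

  All-heights-end : ∀ {p} {P : Pred ℤ p} h s → All P (heights h s) → P (endHeight h s)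
  All-heights-end h []      (ph ∷ _)   = ph
  All-heights-end h (U ∷ s) (_ ∷ phs) = All-heights-end (h ℤ.+ + 1) s phs
  All-heights-end h (D ∷ s) (_ ∷ phs) = All-heights-end (h ℤ.- + 1) s phs

  ≤-minHeight⇔All≤-heights : ∀ j h s → j ℤ.≤ minHeight h s ⇔ All (j ℤ.≤_) (heights h s)
  ≤-minHeight⇔All≤-heights j h s = mk⇔ (to h s) (from h s)
    where
    to : ∀ h s → j ℤ.≤ minHeight h s → All (j ℤ.≤_) (heights h s)
    to h []      j≤h = j≤h ∷ []
    to h (U ∷ s) j≤m = ℤ.≤-trans j≤m (ℤ.i⊓j≤i h _) ∷ to (h ℤ.+ + 1) s (ℤ.≤-trans j≤m (ℤ.i⊓j≤j h _))
    to h (D ∷ s) j≤m = ℤ.≤-trans j≤m (ℤ.i⊓j≤i h _) ∷ to (h ℤ.- + 1) s (ℤ.≤-trans j≤m (ℤ.i⊓j≤j h _))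
    from : ∀ h s → All (j ℤ.≤_) (heights h s) → j ℤ.≤ minHeight h s
    from h []      (j≤h ∷ [])  = j≤h
    from h (U ∷ s) (j≤h ∷ j≤s) = ℤ.⊓-glb j≤h (from (h ℤ.+ + 1) s j≤s)
    from h (D ∷ s) (j≤h ∷ j≤s) = ℤ.⊓-glb j≤h (from (h ℤ.- + 1) s j≤s)

  ≡+⇔≤∧≱suc : ∀ i m → i ≡ + m ⇔ (+ m ℤ.≤ i × ¬ (+ suc m ℤ.≤ i))
  ≡+⇔≤∧≱suc i m = mk⇔ to (from i)
    where
    to : i ≡ + m → + m ℤ.≤ i × ¬ (+ suc m ℤ.≤ i)
    to refl = ℤ.≤-refl , ℕ.1+n≰n ∘ ℤ.drop‿+≤+
    from : ∀ i → + m ℤ.≤ i × ¬ (+ suc m ℤ.≤ i) → i ≡ + m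
    from (+ x) (+≤+ m≤x , m+1≰x) = cong +_ (ℕ.≤-antisym (ℕ.≤-pred (ℕ.≰⇒> (m+1≰x ∘ +≤+))) m≤x)

  WalkAbove : ℤ → ℤ → ℤ → Pred (List Step) _
  WalkAbove j h e s = endHeight h s ≡ e × All (j ℤ.≤_) (heights h s)

  walkAbove? : ∀ j h e → Decidable (WalkAbove j h e)
  walkAbove? j h e s = (endHeight h s ℤ.≟ e) ×-dec all? (j ℤ.≤?_) (heights h s)

  WalkAbove-U : ∀ {j h e s} → j ℤ.≤ h → WalkAbove j h e (U ∷ s) ⇔ WalkAbove j (h ℤ.+ + 1) e s
  WalkAbove-U j≤h = mk⇔ (λ { (end , _ ∷ above) → end , above }) (λ (end , above) → end , j≤h ∷ above)

  WalkAbove-D : ∀ {j h e s} → j ℤ.≤ h → WalkAbove j h e (D ∷ s) ⇔ WalkAbove j (h ℤ.- + 1) e s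
  WalkAbove-D j≤h = mk⇔ (λ { (end , _ ∷ above) → end , above }) (λ (end , above) → end , j≤h ∷ above)

  count-walkAbove : ∀ k j a b → count (walkAbove? (+ j) (+ (j + a)) (+ (j + b))) (allSeqs k) ≡ walks k a b
  count-walkAbove zero j a b with a ℕ.≟ b
  ... | yes refl = trans (cong length (filter-accept (walkAbove? (+ j) (+ (j + a)) (+ (j + a))) {[]} {[]} walk))
                         (sym (δ-diag a))
    where
    walk : WalkAbove (+ j) (+ (j + a)) (+ (j + a)) []
    walk = refl , +≤+ (ℕ.m≤m+n j a) ∷ []
  ... | no a≢b   = trans (cong length (filter-reject (walkAbove? (+ j) (+ (j + a)) (+ (j + b))) {[]} {[]} ¬walk))
                         (sym (δ-off a b a≢b))
    where
    ¬walk : ¬ WalkAbove (+ j) (+ (j + a)) (+ (j + b)) []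
    ¬walk (j+a≡j+b , _) = a≢b (ℕ.+-cancelˡ-≡ j a b (ℤ.+-injective j+a≡j+b))
  count-walkAbove (suc k) j a b = trans (count-allSeqs-suc (W? a) k) (first-step a)
    where
    W? : ∀ a → Decidable (WalkAbove (+ j) (+ (j + a)) (+ (j + b)))
    W? a = walkAbove? (+ j) (+ (j + a)) (+ (j + b))
    start : ∀ a → + j ℤ.≤ + (j + a)
    start a = +≤+ (ℕ.m≤m+n j a)
    up : ∀ a → count (W? a ∘ (U ∷_)) (allSeqs k) ≡ walks k (suc a) b
    up a = begin
      count (W? a ∘ (U ∷_)) (allSeqs k)
        ≡⟨ count-cong _ _ (All.universal (λ _ → WalkAbove-U (start a)) (allSeqs k)) ⟩
      count (walkAbove? (+ j) (+ (j + a + 1)) (+ (j + b))) (allSeqs k)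
        ≡⟨ cong (λ x → count (walkAbove? (+ j) (+ x) (+ (j + b))) (allSeqs k))
                (trans (ℕ.+-comm (j + a) 1) (sym (ℕ.+-suc j a))) ⟩
      count (W? (suc a)) (allSeqs k)
        ≡⟨ count-walkAbove k j (suc a) b ⟩
      walks k (suc a) b ∎
    down : ∀ a → count (W? (suc a) ∘ (D ∷_)) (allSeqs k) ≡ walks k a b
    down a = begin
      count (W? (suc a) ∘ (D ∷_)) (allSeqs k)
        ≡⟨ count-cong _ _ (All.universal (λ _ → WalkAbove-D (start (suc a))) (allSeqs k)) ⟩
      count (walkAbove? (+ j) (+ (j + suc a) ℤ.- + 1) (+ (j + b))) (allSeqs k)
        ≡⟨ cong (λ x → count (walkAbove? (+ j) (+ x ℤ.- + 1) (+ (j + b))) (allSeqs k)) (ℕ.+-suc j a) ⟩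
      count (W? a) (allSeqs k)
        ≡⟨ count-walkAbove k j a b ⟩
      walks k a b ∎
    j≰j-1 : ¬ (+ j ℤ.≤ + (j + 0) ℤ.- + 1)
    j≰j-1 j≤j-1 = ℕ.<-irrefl (sym (ℕ.+-identityʳ j))
                    (ℤ.drop‿+<+ (ℤ.≤-<-trans j≤j-1 (ℤ.m⊖1+n<m (j + 0) 1)))
    down-from-0 : count (W? 0 ∘ (D ∷_)) (allSeqs k) ≡ 0
    down-from-0 = count-none _ (All.universal (λ { s (_ , _ ∷ above) → j≰j-1 (All-heights-start _ s above) }) (allSeqs k))
    first-step : ∀ a → count (W? a ∘ (U ∷_)) (allSeqs k) + count (W? a ∘ (D ∷_)) (allSeqs k) ≡ walks (suc k) a b
    first-step zero    = trans (cong₂ _+_ (up 0) down-from-0) (ℕ.+-identityʳ _)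
    first-step (suc a) = cong₂ _+_ (up (suc a)) (down a)

  IsPath⇔ : ∀ n α β m s → + length s ≡ pathLength n α β →
    IsPath n α β m s ⇔ (WalkAbove (+ m) (+ α) (+ β) ∩ ∁ (WalkAbove (+ suc m) (+ α) (+ β))) s
  IsPath⇔ n α β m s len = mk⇔
    (λ (_ , end , _ , min≡m) → let m≤min , m+1≰min = Equivalence.to (min≡ _) min≡m in
      (end , to (+ m) m≤min) , λ (_ , above) → m+1≰min (from (+ suc m) above))
    (λ ((end , above) , ¬above) →
      len , end , All.map (ℤ.≤-trans (+≤+ ℕ.z≤n)) above ,
      Equivalence.from (min≡ _) (from (+ m) above , λ m+1≤min → ¬above (end , to (+ suc m) m+1≤min)))
    where
    min≡ : ∀ i → i ≡ + m ⇔ (+ m ℤ.≤ i × ¬ (+ suc m ℤ.≤ i))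
    min≡ i = ≡+⇔≤∧≱suc i m
    to : ∀ j → j ℤ.≤ minHeight (+ α) s → All (j ℤ.≤_) (heights (+ α) s)
    to j = Equivalence.to (≤-minHeight⇔All≤-heights j (+ α) s)
    from : ∀ j → All (j ℤ.≤_) (heights (+ α) s) → j ℤ.≤ minHeight (+ α) s
    from j = Equivalence.from (≤-minHeight⇔All≤-heights j (+ α) s)

  mC2+count-above-suc : ∀ n α β m L → pathLength n α β ≡ + L →
    mC2 m n α β + count (walkAbove? (+ suc m) (+ α) (+ β)) (allSeqs L) ≡
    count (walkAbove? (+ m) (+ α) (+ β)) (allSeqs L)
  mC2+count-above-suc n α β m L pl≡L = begin
    count (isPath? n α β m) (allSeqs ℤ.∣ pathLength n α β ∣) + count Q? (allSeqs L)
      ≡⟨ cong (λ l → count (isPath? n α β m) (allSeqs ℤ.∣ l ∣) + count Q? (allSeqs L)) pl≡L ⟩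
    count (isPath? n α β m) (allSeqs L) + count Q? (allSeqs L)
      ≡⟨ cong (_+ count Q? (allSeqs L))
              (count-cong _ (P? ∩? ∁? Q?) (All.map (λ {s} len → IsPath⇔ n α β m s (trans (cong +_ len) (sym pl≡L)))
                                                   (allSeqs-length L))) ⟩
    count (P? ∩? ∁? Q?) (allSeqs L) + count Q? (allSeqs L)
      ≡⟨ count-difference P? Q? (allSeqs L) (λ (end , above) → end , All.map (ℤ.≤-trans (+≤+ (ℕ.n≤1+n m))) above) ⟩
    count P? (allSeqs L) ∎
    where
    P? : Decidable (WalkAbove (+ m) (+ α) (+ β))
    P? = walkAbove? (+ m) (+ α) (+ β)
    Q? : Decidable (WalkAbove (+ suc m) (+ α) (+ β))
    Q? = walkAbove? (+ suc m) (+ α) (+ β)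

module PathCounts where

  open BinomialCoefficients using (ℕbinom-sym; ℕbinom-ballot)
  open IntegerBinomials
  open NonnegativeWalks using (walks; walks-too-high; walks-reflection)
  open Counting using (count; count-none)
  open LatticePaths
  open import Data.Nat as ℕ using (ℕ; zero; suc; _+_; _*_; _<_; _≤?_)
  import Data.Nat.Properties as ℕ
  open import Data.Nat.Tactic.RingSolver using (solve-∀)
  open import Data.Integer as ℤ using (ℤ; +_; -[1+_])
  import Data.Integer.Properties as ℤ
  import Data.List.Relation.Unary.All as All
  open import Data.Product using (_,_; ∃-syntax)
  open import Data.Sum using (_⊎_; inj₁; inj₂)
  open import Function using (_∘_)
  open import Relation.Nullary using (¬_; yes; no)
  open import Relation.Binary.PropositionalEquality
  open ≡-Reasoning

  count-above : ∀ n m a b u → a + u ≡ n + b →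
    count (walkAbove? (+ m) (+ (m + a)) (+ (m + b))) (allSeqs (u + n)) + ℕbinom (u + n) (suc a + u) ≡
    ℕbinom (u + n) u
  count-above n m a b u a+u≡n+b =
    trans (cong (_+ ℕbinom (u + n) (suc a + u)) (count-walkAbove (u + n) m a b))
          (walks-reflection (u + n) a b u n (trans (ℕ.+-comm b n) (sym a+u≡n+b)) refl)

  +m+1≰+m+0 : ∀ m → ¬ (+ suc m ℤ.≤ + (m + 0))
  +m+1≰+m+0 m = ℕ.<-irrefl (sym (ℕ.+-identityʳ m)) ∘ ℤ.drop‿+≤+

  count-above-suc : ∀ n m a b u → a + u ≡ n + b →
    count (walkAbove? (+ suc m) (+ (m + a)) (+ (m + b))) (allSeqs (u + n)) + ℕbinom (u + n) (a + u) ≡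
    ℕbinom (u + n) u
  count-above-suc n m zero b u _ =
    cong (_+ ℕbinom (u + n) u)
         (count-none (walkAbove? (+ suc m) (+ (m + 0)) (+ (m + b)))
                     (All.universal (λ s (_ , above) → +m+1≰+m+0 m (All-heights-start _ s above)) (allSeqs (u + n))))
  count-above-suc n m (suc a) zero u a+u+1≡n+0 = begin
    count (walkAbove? (+ suc m) (+ (m + suc a)) (+ (m + 0))) (allSeqs (u + n)) + ℕbinom (u + n) (suc a + u)
      ≡⟨ cong (_+ ℕbinom (u + n) (suc a + u))
              (count-none (walkAbove? (+ suc m) (+ (m + suc a)) (+ (m + 0)))
                          (All.universal (λ s (end , above) → +m+1≰+m+0 m (subst (+ suc m ℤ.≤_) end (All-heights-end _ s above)))
                                         (allSeqs (u + n)))) ⟩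
    ℕbinom (u + n) (suc a + u)
      ≡⟨ cong (ℕbinom (u + n)) (trans a+u+1≡n+0 (ℕ.+-identityʳ n)) ⟩
    ℕbinom (u + n) n
      ≡⟨ ℕbinom-sym u n ⟨
    ℕbinom (u + n) u ∎
  count-above-suc n m (suc a) (suc b) u a+u+1≡n+b+1 =
    subst₂ (λ x y → count (walkAbove? (+ suc m) (+ x) (+ y)) (allSeqs (u + n)) + ℕbinom (u + n) (suc a + u) ≡ ℕbinom (u + n) u)
           (sym (ℕ.+-suc m a)) (sym (ℕ.+-suc m b))
           (count-above n (suc m) a b u (ℕ.suc-injective (trans a+u+1≡n+b+1 (ℕ.+-suc n b))))

  reachable-length : ∀ n m a b u → a + u ≡ n + b → 2 * n + (m + b) ≡ (m + a) + (u + n)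
  reachable-length n m a b u a+u≡n+b = begin
    2 * n + (m + b)     ≡⟨ expand n m b ⟩
    m + n + (n + b)     ≡⟨ cong (λ t → m + n + t) a+u≡n+b ⟨
    m + n + (a + u)     ≡⟨ regroup m n a u ⟩
    (m + a) + (u + n)   ∎
    where
    expand : ∀ n m b → 2 * n + (m + b) ≡ m + n + (n + b)
    expand = solve-∀
    regroup : ∀ m n a u → m + n + (a + u) ≡ (m + a) + (u + n)
    regroup = solve-∀

  mC2+ℕbinom : ∀ n m a b u → a + u ≡ n + b →
    mC2 m n (m + a) (m + b) + ℕbinom (u + n) (suc a + u) ≡ ℕbinom (u + n) (a + u)
  mC2+ℕbinom n m a b u a+u≡n+b = ℕ.+-cancelʳ-≡ S (M + C₊) (ℕbinom (u + n) (a + u)) (begin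
    (M + C₊) + S                     ≡⟨ swap M C₊ S ⟩
    (M + S) + C₊                     ≡⟨ cong (_+ C₊) (mC2+count-above-suc n (m + a) (m + b) m (u + n)
                                          (+m-+n≡+o {n = m + a} (reachable-length n m a b u a+u≡n+b))) ⟩
    _ + C₊                           ≡⟨ count-above n m a b u a+u≡n+b ⟩
    ℕbinom (u + n) u                 ≡⟨ count-above-suc n m a b u a+u≡n+b ⟨
    S + ℕbinom (u + n) (a + u)       ≡⟨ ℕ.+-comm S (ℕbinom (u + n) (a + u)) ⟩
    ℕbinom (u + n) (a + u) + S       ∎)
    where
    M C₊ S : ℕ
    M  = mC2 m n (m + a) (m + b)
    C₊ = ℕbinom (u + n) (suc a + u)
    S  = count (walkAbove? (+ suc m) (+ (m + a)) (+ (m + b))) (allSeqs (u + n))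
    swap : ∀ x y z → (x + y) + z ≡ (x + z) + y
    swap = solve-∀

  mC2-ballot : ∀ n m a b u → a + u ≡ n + b →
    suc (u + n) * mC2 m n (m + a) (m + b) ≡ (a + b + 1) * ℕbinom (suc (u + n)) (suc a + u)
  mC2-ballot n m a b u a+u≡n+b =
    ℕbinom-ballot (u + n) (a + u) (a + b + 1) (mC2 m n (m + a) (m + b)) (mC2+ℕbinom n m a b u a+u≡n+b) (begin
      suc (a + u) + suc (a + u)      ≡⟨ expand a u ⟩
      (a + u) + (a + u) + 2          ≡⟨ cong (λ t → t + (a + u) + 2) a+u≡n+b ⟩
      (n + b) + (a + u) + 2          ≡⟨ regroup n b a u ⟩
      suc (u + n) + (a + b + 1)      ∎)
    where
    expand : ∀ a u → suc (a + u) + suc (a + u) ≡ (a + u) + (a + u) + 2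
    expand = solve-∀
    regroup : ∀ n b a u → (n + b) + (a + u) + 2 ≡ suc (u + n) + (a + b + 1)
    regroup = solve-∀

  mC2-vanishing : ∀ n m a b u → a + u ≡ n + b →
    ℕbinom (suc (u + n)) (suc a + u) ≡ 0 → mC2 m n (m + a) (m + b) ≡ 0
  mC2-vanishing n m a b u a+u≡n+b C≡0 =
    ℕ.m+n≡0⇒m≡0 _ (trans (mC2+ℕbinom n m a b u a+u≡n+b) (ℕ.m+n≡0⇒m≡0 (ℕbinom (u + n) (a + u)) C≡0))

  mC2-unreachable : ∀ n m a b → n + b < a → mC2 m n (m + a) (m + b) ≡ 0
  mC2-unreachable n m a b n+b<a with m + a ≤? 2 * n + (m + b)
  ... | no α≰ =
    let _ , pathLength≡-[1+z] = m<n⇒∃[o]+m-+n≡-[1+o] (ℕ.≰⇒> α≰) in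
    count-none (isPath? n (m + a) (m + b) m)
      (All.universal (λ s (len , _) → +≢-[1+] (trans len pathLength≡-[1+z]))
                     (allSeqs ℤ.∣ pathLength n (m + a) (m + b) ∣))
    where
    +≢-[1+] : ∀ {x z} → + x ≢ -[1+ z ]
    +≢-[1+] ()
  ... | yes α≤ with ℕ.m≤n⇒∃[o]m+o≡n α≤
  ...   | L , α+L≡ = ℕ.m+n≡0⇒m≡0 _ (begin
    mC2 m n (m + a) (m + b) + _                                   ≡⟨ mC2+count-above-suc n (m + a) (m + b) m L (+m-+n≡+o (sym α+L≡)) ⟩
    count (walkAbove? (+ m) (+ (m + a)) (+ (m + b))) (allSeqs L)  ≡⟨ count-walkAbove L m a b ⟩
    walks L a b                                                   ≡⟨ walks-too-high L a b b+L<a ⟩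
    0                                                             ∎)
    where
    lhs : b + L + (a + m) ≡ (n + b) + ((n + b) + m)
    lhs = begin
      b + L + (a + m)                ≡⟨ regroup b L a m ⟩
      b + (m + a + L)                ≡⟨ cong (λ t → b + t) α+L≡ ⟩
      b + (2 * n + (m + b))          ≡⟨ expand b n m ⟩
      (n + b) + ((n + b) + m)        ∎
      where
      regroup : ∀ b L a m → b + L + (a + m) ≡ b + (m + a + L)
      regroup = solve-∀
      expand : ∀ b n m → b + (2 * n + (m + b)) ≡ (n + b) + ((n + b) + m)
      expand = solve-∀
    b+L<a : b + L < a
    b+L<a = ℕ.+-cancelʳ-< (a + m) (b + L) a
              (subst (_< a + (a + m)) (sym lhs) (ℕ.+-mono-< n+b<a (ℕ.+-monoˡ-< m n+b<a)))

  reachable? : ∀ n a b → (∃[ u ] a + u ≡ n + b) ⊎ n + b < a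
  reachable? n a b with a ≤? n + b
  ... | yes a≤n+b = inj₁ (ℕ.m≤n⇒∃[o]m+o≡n a≤n+b)
  ... | no  a≰n+b = inj₂ (ℕ.≰⇒> a≰n+b)

  record BallotFormula (M : ℕ) (N X B : ℤ) : Set where
    field
      vanishes : B ≡ + 0 → + M ≡ + 0
      scaled   : N ℤ.* + M ≡ X ℤ.* B

  ballotFormula-+ : ∀ {M N X B} → (B ≡ 0 → M ≡ 0) → N * M ≡ X * B → BallotFormula M (+ N) (+ X) (+ B)
  ballotFormula-+ {M} {N} {X} {B} B≡0⇒M≡0 N*M≡X*B = record
    { vanishes = λ B≡0 → cong +_ (B≡0⇒M≡0 (ℤ.+-injective B≡0))
    ; scaled   = trans (sym (ℤ.pos-* N M)) (trans (cong +_ N*M≡X*B) (ℤ.pos-* X B))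
    }

  ballotFormula-0 : ∀ {N X B} → B ≡ + 0 → BallotFormula 0 N X B
  ballotFormula-0 {N} {X} refl = record
    { vanishes = λ _ → refl
    ; scaled   = trans (ℤ.*-zeroʳ N) (sym (ℤ.*-zeroʳ X))
    }

  pathLength+1 : ℕ → ℕ → ℕ → ℤ
  pathLength+1 n α β = + (2 * n + β + 1) ℤ.- + α

  ballotWeight : ℕ → ℕ → ℕ → ℤ
  ballotWeight α β m = + (α + β + 1) ℤ.- + (2 * m)

  pathLength+1-reachable : ∀ n m a b u → a + u ≡ n + b → pathLength+1 n (m + a) (m + b) ≡ + suc (u + n)
  pathLength+1-reachable n m a b u a+u≡n+b = +m-+n≡+o {n = m + a} (begin
    2 * n + (m + b) + 1      ≡⟨ cong (_+ 1) (reachable-length n m a b u a+u≡n+b) ⟩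
    m + a + (u + n) + 1      ≡⟨ ℕ.+-assoc (m + a) (u + n) 1 ⟩
    m + a + (u + n + 1)      ≡⟨ cong (λ t → m + a + t) (ℕ.+-comm (u + n) 1) ⟩
    m + a + suc (u + n)      ∎)

  binomℤ-reachable : ∀ n m a u → binomℤ (+ suc (u + n)) (+ (n + m) ℤ.- + (m + a)) ≡ + ℕbinom (suc (u + n)) (suc a + u)
  binomℤ-reachable n m a u = binomℤ-complement (suc (u + n)) (n + m) (m + a) (suc a + u) (rearrange n m a u)
    where
    rearrange : ∀ n m a u → suc (u + n) + (m + a) ≡ n + m + (suc a + u)
    rearrange = solve-∀

  ballotWeight-shifted : ∀ m a b → ballotWeight (m + a) (m + b) m ≡ + (a + b + 1)
  ballotWeight-shifted m a b = +m-+n≡+o {n = 2 * m} (rearrange m a b)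
    where
    rearrange : ∀ m a b → m + a + (m + b) + 1 ≡ 2 * m + (a + b + 1)
    rearrange = solve-∀

  unreachable-index : ∀ n m a b → n + b < a → n + m < m + a
  unreachable-index n m a b n+b<a =
    subst (n + m <_) (ℕ.+-comm a m) (ℕ.≤-<-trans (ℕ.+-monoˡ-≤ m (ℕ.m≤m+n n b)) (ℕ.+-monoˡ-< m n+b<a))

  corollary-shifted : ∀ n m a b →
    let N = pathLength+1 n (m + a) (m + b) in
    BallotFormula (mC2 m n (m + a) (m + b)) N (ballotWeight (m + a) (m + b) m) (binomℤ N (+ (n + m) ℤ.- + (m + a)))
  corollary-shifted n m a b with reachable? n a b
  ... | inj₂ n+b<a rewrite mC2-unreachable n m a b n+b<a =
    ballotFormula-0 (m<n⇒binomℤ[+m-+n]≡0 (pathLength+1 n (m + a) (m + b)) (unreachable-index n m a b n+b<a))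
  ... | inj₁ (u , a+u≡n+b)
    rewrite pathLength+1-reachable n m a b u a+u≡n+b | binomℤ-reachable n m a u | ballotWeight-shifted m a b =
    ballotFormula-+ (mC2-vanishing n m a b u a+u≡n+b) (mC2-ballot n m a b u a+u≡n+b)

open PathCounts using (BallotFormula; corollary-shifted)

open import Data.Nat using (ℕ; _≤_)
open import Data.Nat.Properties using (m≤n⇒∃[o]m+o≡n)
open import Data.Integer using (+_; _-_; _*_)
open import Data.Product using (_×_; _,_)
open import Relation.Binary.PropositionalEquality using (_≡_; refl)

corollary3p5 : (n α β m : ℕ) → m ≤ α → m ≤ β →
    let N = + (2 Data.Nat.* n Data.Nat.+ β Data.Nat.+ 1) - + α
        B = binomℤ N (+ (n Data.Nat.+ m) - + α)
    in (B ≡ + 0 → + mC2 m n α β ≡ + 0) ×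
       (N * + mC2 m n α β ≡ (+ (α Data.Nat.+ β Data.Nat.+ 1) - + (2 Data.Nat.* m)) * B)
corollary3p5 n α β m m≤α m≤β with m≤n⇒∃[o]m+o≡n m≤α | m≤n⇒∃[o]m+o≡n m≤β
... | a , refl | b , refl = vanishes , scaled
  where open BallotFormula (corollary-shifted n m a b)
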